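{- Let $J$ be a non-trivial model of $\mathrm{FEA}(L)$, and let $Q$ and $Q'$ be consistent queries in solved form. If $Q\preceq_J Q'$, then $|\mathrm{ELIM}(Q)|\ge|\mathrm{ELIM}(Q')|$.
   Context: $L$ is a first-order language with equality whose function symbols include at least one constant. $\mathrm{FEA}(L)$ (free equality axioms): $f(\bar x)=f(\bar y)\leftrightarrow x_1=y_1\wedge\dots\wedge x_n=y_n$ for each $n$-ary $f$; $f(\bar x)=g(\bar y)\leftrightarrow\mathit{False}$ for distinct $f,g$; $x=t\leftrightarrow\mathit{False}$ whenever $x\not\equiv t$ occurs in $t$. A pre-interpretation $J$: nonempty domain $U_J$, interpretation of function symbols, $=$ identity; $V_J$ the set of $J$-valuations; $J$ is a non-trivial model of $\mathrm{FEA}(L)$ if the axioms hold in $J$ and $|U_J|\ge2$. Interpretations based on $J$ are subsets of the $J$-base (all $p(d_1,\dots,d_n)$, $p$ non-equality predicate, $d_i\in U_J$); a multiinterpretation is a finite sequence of them. A query is built from $\mathit{True}$, $\mathit{False}$, equations and atoms using only $\wedge,\exists$; $|Q|$ = number of atom occurrences. $\mathrm{Sol}_J(Q,\bar I)$ for $|\bar I|=|Q|$: $V_J$ for $\mathit{True}$, $\emptyset$ for $\mathit{False}$, $\{h:h(s)=h(t)\}$ for $s=t$, $\{h:h(A)\in I\}$ for atom $A$ with $(I)$, intersection for $Q_1\wedge Q_2$ with $\bar I_1\bar I_2$ split by $|Q_1|,|Q_2|$, and $\{h: h[x\mapsto d]\in\mathrm{Sol}_J(Q,\bar I)$ for some $d\}$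 for $(\exists x)Q$. $Q\preceq_J Q'$ iff $|Q|=|Q'|$ and $\mathrm{Sol}_J(Q,\bar I)\subseteq\mathrm{Sol}_J(Q',\bar I)$ for all $\bar I$ of length $|Q|$ based on $J$. Solved form: $\mathit{True}$, $\mathit{False}$, or $(\exists z_1)\dots(\exists z_k)(x_1=s_1\wedge\dots\wedge x_n=s_n\wedge A_1\wedge\dots\wedge A_m)$ with the $x_i,z_j$ pairwise distinct variables, no $x_i$ in any $s_j$ or atom, each $z_j$ occurring in the conjunction, $z_j\not\equiv s_i$; $\mathrm{ELIM}(Q)=\{x_1,\dots,x_n\}$ ($\emptyset$ for $\mathit{True}$). $Q$ is consistent if $\mathrm{FEA}(L)\not\models\neg Q$. -}

module Defs where

open import Data.Nat using (ℕ; _+_; _≟_)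
open import Data.Bool using (if_then_else_)
open import Data.Product using (Σ; _×_; _,_; proj₁; proj₂)
open import Data.List using (List; []; _∷_; map; _++_)
open import Data.List.Membership.Propositional using (_∈_)
open import Data.List.Relation.Unary.Unique.Propositional using (Unique)
open import Data.Vec using (Vec; []; _∷_; take; drop)
open import Data.Vec.Relation.Binary.Pointwise.Inductive using (Pointwise)
open import Data.Unit using (⊤)
open import Data.Sum using (_⊎_)
open import Data.Empty using (⊥)
open import Relation.Nullary using (¬_; does)
open import Relation.Binary.PropositionalEquality using (_≡_; _≢_; subst)
open import Function.Bundles using (_⇔_)
open import Level using (0ℓ)

-- First-order language (variables are natural numbers).
-- Equality is not among the predicate symbols `Pred`.

record Lang : Set₁ where
  field
    Fun       : Set
    arity     : Fun → ℕ
    Pred      : Set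
    parity    : Pred → ℕ
    const     : Fun
    const-ar  : arity const ≡ 0

Var : Set
Var = ℕ

module _ (L : Lang) where
  open Lang L

  data Term : Set where
    var : Var → Term
    fn  : (f : Fun) → Vec Term (arity f) → Term

  data Atom : Set where
    mkAtom : (p : Pred) → Vec Term (parity p) → Atom

  data Query : Set where
    true  : Query
    false : Query
    eq    : Term → Term → Query
    at    : Atom → Query
    _∧_   : Query → Query → Query
    ex    : Var → Query → Query

  record PreInterp : Set₁ where
    field
      U   : Set
      fun : (f : Fun) → Vec U (arity f) → U

module _ {L : Lang} where
  open Lang L
  open PreInterp

  size : Query L → ℕ
  size true      = 0
  size false     = 0
  size (eq s t)  = 0
  size (at a)    = 1
  size (Q₁ ∧ Q₂) = size Q₁ + size Q₂
  size (ex x Q)  = size Q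

  mutual
    _occursIn_ : Var → Term L → Set
    x occursIn var y    = x ≡ y
    x occursIn fn f ts  = x occursInAll ts

    _occursInAll_ : ∀ {n} → Var → Vec (Term L) n → Set
    x occursInAll []       = ⊥
    x occursInAll (t ∷ ts) = (x occursIn t) ⊎ (x occursInAll ts)

  _occursInAtom_ : Var → Atom L → Set
  x occursInAtom mkAtom p ts = x occursInAll ts

  _occursInQ_ : Var → Query L → Set
  x occursInQ true      = ⊥
  x occursInQ false     = ⊥
  x occursInQ eq s t    = (x occursIn s) ⊎ (x occursIn t)
  x occursInQ at a      = x occursInAtom a
  x occursInQ (Q₁ ∧ Q₂) = (x occursInQ Q₁) ⊎ (x occursInQ Q₂)
  x occursInQ ex y Q    = (x ≡ y) ⊎ (x occursInQ Q)

  Valuation : PreInterp L → Set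
  Valuation J = Var → U J

  _[_↦_] : {J : PreInterp L} → Valuation J → Var → U J → Valuation J
  (_[_↦_] {J} h x d) y = if does (y ≟ x) then d else h y

  mutual
    eval : (J : PreInterp L) → Term L → Valuation J → U J
    eval J (var x)   h = h x
    eval J (fn f ts) h = fun J f (evals J ts h)

    evals : ∀ {n} (J : PreInterp L) → Vec (Term L) n → Valuation J → Vec (U J) n
    evals J []       h = []
    evals J (t ∷ ts) h = eval J t h ∷ evals J ts h

  Interp : PreInterp L → Set₁
  Interp J = (p : Pred) → Vec (U J) (parity p) → Set

  Sol : (J : PreInterp L) (Q : Query L) → Vec (Interp J) (size Q) → Valuation J → Set
  Sol J true      Is       h = ⊤
  Sol J false     Is       h = ⊥
  Sol J (eq s t)  Is       h = eval J s h ≡ eval J t h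
  Sol J (at (mkAtom p ts)) (I ∷ []) h = I p (evals J ts h)
  Sol J (Q₁ ∧ Q₂) Is       h =
    Sol J Q₁ (take (size Q₁) Is) h × Sol J Q₂ (drop (size Q₁) Is) h
  Sol J (ex x Q)  Is       h = Σ (U J) λ d → Sol J Q Is (_[_↦_] {J} h x d)

  _≼[_]_ : Query L → PreInterp L → Query L → Set₁
  Q ≼[ J ] Q' = Σ (size Q ≡ size Q') λ e →
    ∀ (Is : Vec (Interp J) (size Q)) (h : Valuation J) →
      Sol J Q Is h → Sol J Q' (subst (Vec (Interp J)) e Is) h

  Holds : (J : PreInterp L) → Interp J → Query L → Valuation J → Set
  Holds J I true      h = ⊤
  Holds J I false     h = ⊥
  Holds J I (eq s t)  h = eval J s h ≡ eval J t h
  Holds J I (at (mkAtom p ts)) h = I p (evals J ts h)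
  Holds J I (Q₁ ∧ Q₂) h = Holds J I Q₁ h × Holds J I Q₂ h
  Holds J I (ex x Q)  h = Σ (U J) λ d → Holds J I Q (_[_↦_] {J} h x d)

  record FEA (J : PreInterp L) : Set where
    field
      fea-inj   : ∀ f (xs ys : Vec (U J) (arity f)) →
                  (fun J f xs ≡ fun J f ys) ⇔ Pointwise _≡_ xs ys
      fea-clash : ∀ f g → f ≢ g → ∀ (xs : Vec (U J) (arity f)) (ys : Vec (U J) (arity g)) →
                  (fun J f xs ≡ fun J g ys) ⇔ ⊥
      fea-occur : ∀ (x : Var) (t : Term L) → x occursIn t → t ≢ var x →
                  ∀ (h : Valuation J) → (h x ≡ eval J t h) ⇔ ⊥

  NonTrivialModel : PreInterp L → Set
  NonTrivialModel J = FEA J × Σ (U J) λ d₁ → Σ (U J) λ d₂ → d₁ ≢ d₂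

  Consistent : Query L → Set₁
  Consistent Q = ¬ (∀ (J : PreInterp L) (I : Interp J) → FEA J →
                      ∀ (h : Valuation J) → ¬ Holds J I Q h)

  -- Solved form  (∃z₁)…(∃z_k)(x₁=s₁ ∧ … ∧ x_n=s_n ∧ A₁ ∧ … ∧ A_m),
  -- conjunction nested to the right.

  record SFData : Set where
    field
      zs  : List Var
      eqs : List (Var × Term L)
      ats : List (Atom L)

  conj : List (Query L) → Query L
  conj []           = true
  conj (Q ∷ [])     = Q
  conj (Q ∷ R ∷ Qs) = Q ∧ conj (R ∷ Qs)

  exs : List Var → Query L → Query L
  exs []       Q = Q
  exs (z ∷ zs) Q = ex z (exs zs Q)

  sfBody : SFData → Query L
  sfBody r = conj (map (λ e → eq (var (proj₁ e)) (proj₂ e)) (SFData.eqs r)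
                   ++ map at (SFData.ats r))

  sfQuery : SFData → Query L
  sfQuery r = exs (SFData.zs r) (sfBody r)

  sfElim : SFData → List Var
  sfElim r = map proj₁ (SFData.eqs r)

  record SFWellFormed (r : SFData) : Set where
    open SFData r
    field
      distinct   : Unique (sfElim r ++ zs)
      x-not-in-s : ∀ {x} → x ∈ sfElim r → ∀ {e} → e ∈ eqs → ¬ (x occursIn proj₂ e)
      x-not-in-A : ∀ {x} → x ∈ sfElim r → ∀ {A} → A ∈ ats → ¬ (x occursInAtom A)
      z-occurs   : ∀ {z} → z ∈ zs → z occursInQ sfBody r
      z-not-s    : ∀ {z} → z ∈ zs → ∀ {e} → e ∈ eqs → proj₂ e ≢ var z

  data SolvedForm (Q : Query L) : Set where
    sf-true  : Q ≡ true → SolvedForm Q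
    sf-false : Q ≡ false → SolvedForm Q
    sf-ex    : (r : SFData) → SFWellFormed r → sfQuery r ≡ Q → SolvedForm Q

  ELIM : {Q : Query L} → SolvedForm Q → List Var
  ELIM (sf-true _)   = []
  ELIM (sf-false _)  = []
  ELIM (sf-ex r _ _) = sfElim r

-- Every valuation g can be corrected on ELIM(Q) alone into a solution of Q: overwrite each
-- eliminated x by the value of its right-hand side (which does not mention eliminated
-- variables) and make all atoms true. By Q ≼ Q' the corrected valuation also solves Q', so
-- each equation v = s of Q' holds after changing g only on ELIM(Q) and the bound variables
-- of Q'. Since J is a non-trivial model of FEA, no function symbol is onto; hence, for v
-- outside ELIM(Q), s must be a variable w in ELIM(Q), and two distinct such v cannot share
-- the same w (choose g separating them). Sending v to itself if v ∈ ELIM(Q) and to w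
-- otherwise is therefore an injection ELIM(Q') → ELIM(Q).
module Submission where

open import Defs
open import Data.Nat using (_≤_; z≤n; s≤s; _≟_)
open import Data.Nat.Properties using (module ≤-Reasoning)
open import Data.Bool using (if_then_else_)
open import Data.List using (List; []; _∷_; length; map; _++_)
open import Data.List.Properties using (length-map; length-removeAt′)
open import Data.List.Membership.Propositional using (_∈_; _∉_; _─_)
open import Data.List.Membership.Propositional.Properties using (∈-map⁺; ∈-map⁻; ∈-++⁺ˡ; ∈-++⁺ʳ; ∈-++⁻)
open import Data.List.Membership.DecPropositional _≟_ using (_∈?_)
open import Data.List.Relation.Binary.Subset.Propositional using (_⊆_)
open import Data.List.Relation.Unary.Any using (here; there; index)
import Data.List.Relation.Unary.All as All
open import Data.List.Relation.Unary.All.Properties using (++⁻ˡ; map⁺)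
open import Data.List.Relation.Unary.AllPairs using ([]; _∷_)
open import Data.List.Relation.Unary.Unique.Propositional using (Unique)
open import Data.Vec using (Vec; []; _∷_)
import Data.Vec.Relation.Unary.All as VecAll
import Data.Vec.Relation.Unary.All.Properties as VecAll
open import Data.Product using (∃; _×_; _,_; proj₁; proj₂)
open import Data.Sum using (inj₁; inj₂)
open import Data.Unit using (tt)
open import Data.Empty using (⊥-elim)
open import Relation.Nullary using (¬_; yes; no)
open import Relation.Nullary.Decidable using (dec-true; dec-false)
open import Relation.Binary.PropositionalEquality
  using (_≡_; _≢_; refl; sym; trans; cong; cong₂; subst; module ≡-Reasoning)
open import Function using (_∘_)
open import Function.Bundles using (Equivalence)

module _ {a} {A : Set a} where

  ∈-─⁺ : ∀ {x y} {xs : List A} → x ∈ xs → (y∈xs : y ∈ xs) → x ≢ y → x ∈ xs ─ y∈xs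
  ∈-─⁺ (here refl)  (here refl)  x≢y = ⊥-elim (x≢y refl)
  ∈-─⁺ (here x≡z)   (there _)    _   = here x≡z
  ∈-─⁺ (there x∈xs) (here _)     _   = x∈xs
  ∈-─⁺ (there x∈xs) (there y∈xs) x≢y = there (∈-─⁺ x∈xs y∈xs x≢y)

  Unique⇒length≤ : ∀ {ys xs : List A} → Unique ys → ys ⊆ xs → length ys ≤ length xs
  Unique⇒length≤ [] _ = z≤n
  Unique⇒length≤ {y ∷ ys} {xs} (y∉ys ∷ ys!) ys⊆xs = begin
    length (y ∷ ys)          ≤⟨ s≤s (Unique⇒length≤ ys! ys⊆xs─y) ⟩
    length (y ∷ xs ─ y∈xs)   ≡⟨ length-removeAt′ xs (index y∈xs) ⟨
    length xs                ∎
    where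
      open ≤-Reasoning
      y∈xs = ys⊆xs (here refl)
      ys⊆xs─y : ys ⊆ xs ─ y∈xs
      ys⊆xs─y z∈ys = ∈-─⁺ (ys⊆xs (there z∈ys)) y∈xs (λ z≡y → All.lookup y∉ys z∈ys (sym z≡y))

  Unique-++⁻ˡ : ∀ xs {ys : List A} → Unique (xs ++ ys) → Unique xs
  Unique-++⁻ˡ []       _                = []
  Unique-++⁻ˡ (x ∷ xs) (x∉ ∷ xs++ys!) = ++⁻ˡ xs x∉ ∷ Unique-++⁻ˡ xs xs++ys!

  Unique-++⇒∉ʳ : ∀ xs {ys : List A} {x} → Unique (xs ++ ys) → x ∈ xs → x ∉ ys
  Unique-++⇒∉ʳ (x ∷ xs) (x∉ ∷ _)      (here refl) x∈ys = All.lookup x∉ (∈-++⁺ʳ xs x∈ys) refl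
  Unique-++⇒∉ʳ (_ ∷ xs) (_ ∷ xs++ys!) (there x∈xs) = Unique-++⇒∉ʳ xs xs++ys! x∈xs

  Vec-length-zero-≡ : ∀ {n} → n ≡ 0 → (xs ys : Vec A n) → xs ≡ ys
  Vec-length-zero-≡ refl [] [] = refl

  Unique-map-finer : ∀ {b c} {B : Set b} {C : Set c} {f : A → B} {g : A → C} {xs : List A} →
                     (∀ {x y} → x ∈ xs → y ∈ xs → f x ≢ f y → g x ≢ g y) →
                     Unique (map f xs) → Unique (map g xs)
  Unique-map-finer {xs = []} _ [] = []
  Unique-map-finer {f = f} {xs = x ∷ xs} sep (fx∉ ∷ fxs!) =
    map⁺ (All.tabulate (λ y∈xs → sep (here refl) (there y∈xs) (All.lookup fx∉ (∈-map⁺ f y∈xs))))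
    ∷ Unique-map-finer (λ x∈xs y∈xs → sep (there x∈xs) (there y∈xs)) fxs!

module _ {L : Lang} {J : PreInterp L} where
  open Lang L
  open PreInterp J

  _[_≔_] : Valuation J → Var → U → Valuation J
  _[_≔_] = _[_↦_] {J = J}

  [≔]-≡ : ∀ h x d → (h [ x ≔ d ]) x ≡ d
  [≔]-≡ h x d = cong (if_then d else h x) (dec-true (x ≟ x) refl)

  [≔]-≢ : ∀ h x d {y} → y ≢ x → (h [ x ≔ d ]) y ≡ h y
  [≔]-≢ h x d {y} y≢x = cong (if_then d else h y) (dec-false (y ≟ x) y≢x)

  [≔]-self : ∀ h x y → (h [ x ≔ h x ]) y ≡ h y
  [≔]-self h x y with y ≟ x
  ... | yes refl = [≔]-≡ h x (h x)
  ... | no y≢x   = [≔]-≢ h x (h x) y≢x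

  [≔]-cong : ∀ {h h' : Valuation J} x d → (∀ v → h v ≡ h' v) → ∀ v → (h [ x ≔ d ]) v ≡ (h' [ x ≔ d ]) v
  [≔]-cong {h} {h'} x d h≗h' v with v ≟ x
  ... | yes refl = trans ([≔]-≡ h x d) (sym ([≔]-≡ h' x d))
  ... | no v≢x   = trans ([≔]-≢ h x d v≢x) (trans (h≗h' v) (sym ([≔]-≢ h' x d v≢x)))

  mutual
    eval-cong : ∀ t {h h' : Valuation J} → (∀ v → v occursIn t → h v ≡ h' v) → eval J t h ≡ eval J t h'
    eval-cong (var x)   h≗h' = h≗h' x refl
    eval-cong (fn f ts) h≗h' = cong (fun f) (evals-cong ts h≗h')

    evals-cong : ∀ {n} (ts : Vec (Term L) n) {h h' : Valuation J} →
                 (∀ v → v occursInAll ts → h v ≡ h' v) → evals J ts h ≡ evals J ts h'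
    evals-cong []       _    = refl
    evals-cong (t ∷ ts) h≗h' =
      cong₂ _∷_ (eval-cong t (λ v o → h≗h' v (inj₁ o))) (evals-cong ts (λ v o → h≗h' v (inj₂ o)))

  Sol-cong : ∀ Q {Is} {h h' : Valuation J} → (∀ v → h v ≡ h' v) → Sol J Q Is h → Sol J Q Is h'
  Sol-cong true      _    _         = tt
  Sol-cong (eq s t)  h≗h' s≡t       =
    trans (sym (eval-cong s (λ v _ → h≗h' v))) (trans s≡t (eval-cong t (λ v _ → h≗h' v)))
  Sol-cong (at (mkAtom p ts)) {I ∷ []} h≗h' I∋ = subst (I p) (evals-cong ts (λ v _ → h≗h' v)) I∋
  Sol-cong (Q₁ ∧ Q₂) h≗h' (s₁ , s₂) = Sol-cong Q₁ h≗h' s₁ , Sol-cong Q₂ h≗h' s₂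
  Sol-cong (ex x Q)  h≗h' (d , s)   = d , Sol-cong Q ([≔]-cong x d h≗h') s

  Total : Interp J → Set
  Total I = ∀ p ds → I p ds

  TotalSol : Query L → Valuation J → Set₁
  TotalSol Q h = ∀ {Is} → VecAll.All Total Is → Sol J Q Is h

  Sol-conj⁻ : ∀ qs {Is h} → Sol J (conj qs) Is h → ∀ {q} → q ∈ qs → ∃ λ Is' → Sol J q Is' h
  Sol-conj⁻ (q ∷ [])     s         (here refl) = _ , s
  Sol-conj⁻ (q ∷ _ ∷ _)  (s , _)   (here refl) = _ , s
  Sol-conj⁻ (_ ∷ q ∷ qs) (_ , s)   (there q∈)  = Sol-conj⁻ (q ∷ qs) s q∈

  Sol-conj⁺ : ∀ qs {h} → (∀ {q} → q ∈ qs → TotalSol q h) → TotalSol (conj qs) h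
  Sol-conj⁺ []           _   _     = tt
  Sol-conj⁺ (q ∷ [])     sol total = sol (here refl) total
  Sol-conj⁺ (q ∷ r ∷ qs) sol total =
    sol (here refl) (VecAll.take⁺ (size q) total) ,
    Sol-conj⁺ (r ∷ qs) (λ q∈ → sol (there q∈)) (VecAll.drop⁺ (size q) total)

  Sol-exs⁺ : ∀ zs {Q h} → TotalSol Q h → TotalSol (exs zs Q) h
  Sol-exs⁺ []                 sol       = sol
  Sol-exs⁺ (z ∷ zs) {Q} {h} sol total =
    h z , Sol-exs⁺ zs (λ total' → Sol-cong Q (λ v → sym ([≔]-self h z v)) (sol total')) total

  Sol-exs⁻ : ∀ zs {Q Is h} → Sol J (exs zs Q) Is h →
             ∃ λ h' → (∀ v → v ∉ zs → h' v ≡ h v) × ∃ λ Is' → Sol J Q Is' h'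
  Sol-exs⁻ []                       s = _ , (λ _ _ → refl) , _ , s
  Sol-exs⁻ (z ∷ zs) {h = h} (d , s) with Sol-exs⁻ zs s
  ... | h' , h'≗h[z≔d] , sol =
    h' , (λ v v∉ → trans (h'≗h[z≔d] v (v∉ ∘ there)) ([≔]-≢ h z d (v∉ ∘ here))) , sol

  SatisfiesEqs : List (Var × Term L) → Valuation J → Set
  SatisfiesEqs E h = ∀ {x s} → (x , s) ∈ E → h x ≡ eval J s h

  private
    eqQ : Var × Term L → Query L
    eqQ e = eq (var (proj₁ e)) (proj₂ e)

  Sol-sfQuery⁻ : ∀ r {Is h} → Sol J (sfQuery r) Is h →
                 ∃ λ h' → (∀ v → v ∉ SFData.zs r → h' v ≡ h v) × SatisfiesEqs (SFData.eqs r) h'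
  Sol-sfQuery⁻ r s with Sol-exs⁻ (SFData.zs r) s
  ... | h' , h'≗h , _ , body = h' , h'≗h , λ e∈ → proj₂ (Sol-conj⁻ _ body (∈-++⁺ˡ (∈-map⁺ eqQ e∈)))

  Sol-sfQuery⁺ : ∀ r {h} → SatisfiesEqs (SFData.eqs r) h → TotalSol (sfQuery r) h
  Sol-sfQuery⁺ r {h} sat = Sol-exs⁺ (SFData.zs r) (Sol-conj⁺ _ conjunct)
    where
      conjunct : ∀ {q} → q ∈ map eqQ (SFData.eqs r) ++ map at (SFData.ats r) → TotalSol q h
      conjunct q∈ with ∈-++⁻ (map eqQ (SFData.eqs r)) q∈
      ... | inj₁ q∈eqs with ∈-map⁻ eqQ q∈eqs
      ...   | _ , e∈ , refl = λ _ → sat e∈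
      conjunct q∈ | inj₂ q∈ats with ∈-map⁻ at q∈ats
      ...   | mkAtom p ts , _ , refl = λ { (I-total VecAll.∷ VecAll.[]) → I-total p _ }

  assign : List (Var × Term L) → Valuation J → Valuation J
  assign []             g v = g v
  assign ((x , s) ∷ E) g v with v ≟ x
  ... | yes _ = eval J s g
  ... | no _  = assign E g v

  assign-∉ : ∀ E g {v} → v ∉ map proj₁ E → assign E g v ≡ g v
  assign-∉ []             g v∉ = refl
  assign-∉ ((x , s) ∷ E) g {v} v∉ with v ≟ x
  ... | yes v≡x = ⊥-elim (v∉ (here v≡x))
  ... | no _    = assign-∉ E g (v∉ ∘ there)

  assign-∈ : ∀ E g → Unique (map proj₁ E) → ∀ {x s} → (x , s) ∈ E → assign E g x ≡ eval J s g
  assign-∈ ((y , t) ∷ E) g (_ ∷ _) {x} (here refl) with x ≟ x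
  ... | yes _   = refl
  ... | no x≢x  = ⊥-elim (x≢x refl)
  assign-∈ ((y , t) ∷ E) g (y∉ ∷ E!) {x} (there x∈) with x ≟ y
  ... | yes refl = ⊥-elim (All.lookup y∉ (∈-map⁺ proj₁ x∈) refl)
  ... | no _     = assign-∈ E g E! x∈

  assign-satisfies : ∀ E g → Unique (map proj₁ E) →
                     (∀ {x} → x ∈ map proj₁ E → ∀ {e} → e ∈ E → ¬ (x occursIn proj₂ e)) →
                     SatisfiesEqs E (assign E g)
  assign-satisfies E g E! lhs∉rhs {x} {s} e∈ =
    trans (assign-∈ E g E! e∈) (eval-cong s (λ v v∈s → sym (assign-∉ E g (λ v∈ → lhs∉rhs v∈ e∈ v∈s))))

  CorrectableOn : List Var → Query L → Set₁
  CorrectableOn X Q = ∀ (g : Valuation J) →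
    ∃ λ (h : Valuation J) → (∀ v → v ∉ X → h v ≡ g v) × ∃ λ Is → Sol J Q Is h

  CorrectableOn-≼ : ∀ {X Q Q'} → CorrectableOn X Q → Q ≼[ J ] Q' → CorrectableOn X Q'
  CorrectableOn-≼ correct (_ , Q⊆Q') g with correct g
  ... | h , h≗g , Is , sol = h , h≗g , _ , Q⊆Q' Is h sol

  SolvedForm-correctable : ∀ {Q} → Consistent Q → (sQ : SolvedForm Q) → CorrectableOn (ELIM sQ) Q
  SolvedForm-correctable _ (sf-true refl) g = g , (λ _ _ → refl) , [] , tt
  SolvedForm-correctable consistent (sf-false refl) = ⊥-elim (consistent (λ _ _ _ _ ()))
  SolvedForm-correctable _ (sf-ex r wf refl) g =
    assign eqs g , (λ v v∉ → assign-∉ eqs g v∉) ,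
    _ , Sol-sfQuery⁺ r (assign-satisfies eqs g (Unique-++⁻ˡ _ distinct) x-not-in-s)
                     (VecAll.tabulate⁺ (λ _ _ _ → tt))
    where
      open SFData r using (eqs)
      open SFWellFormed wf using (distinct; x-not-in-s)

  FEA⇒fun-not-onto : NonTrivialModel J → ∀ f → ¬ (∀ d → ∃ λ ds → d ≡ fun f ds)
  FEA⇒fun-not-onto (fea , d₁ , d₂ , d₁≢d₂) f onto with arity f ≟ 0
  ... | yes arity≡0 = d₁≢d₂ (begin
    d₁                      ≡⟨ proj₂ (onto d₁) ⟩
    fun f (proj₁ (onto d₁)) ≡⟨ cong (fun f) (Vec-length-zero-≡ arity≡0 _ _) ⟩
    fun f (proj₁ (onto d₂)) ≡⟨ proj₂ (onto d₂) ⟨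
    d₂                      ∎)
    where open ≡-Reasoning
  ... | no arity≢0 = Equivalence.to (FEA.fea-clash fea const f const≢f _ _) (proj₂ (onto c))
    where
      c : U
      c = fun const (subst (Vec U) (sym const-ar) [])
      const≢f : const ≢ f
      const≢f refl = arity≢0 const-ar

  module ElimBound (fea : FEA J) {d₁ d₂ : U} (d₁≢d₂ : d₁ ≢ d₂)
                   (X : List Var) (r : SFData) (wf : SFWellFormed r) (correct : CorrectableOn X (sfQuery r)) where
    open SFData r using (zs; eqs)
    open SFWellFormed wf

    corrected-spec : ∀ (g : Valuation J) → ∃ λ (h : Valuation J) →
                     (∀ v → v ∉ X → v ∉ zs → h v ≡ g v) × SatisfiesEqs eqs h
    corrected-spec g with correct g
    ... | h , h≗g , _ , sol with Sol-sfQuery⁻ r sol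
    ... | h' , h'≗h , sat = h' , (λ v v∉X v∉zs → trans (h'≗h v v∉zs) (h≗g v v∉X)) , sat

    corrected : Valuation J → Valuation J
    corrected g = proj₁ (corrected-spec g)

    corrected-agrees : ∀ g v → v ∉ X → v ∉ zs → corrected g v ≡ g v
    corrected-agrees g = proj₁ (proj₂ (corrected-spec g))

    corrected-satisfies : ∀ g → SatisfiesEqs eqs (corrected g)
    corrected-satisfies g = proj₂ (proj₂ (corrected-spec g))

    elim∉zs : ∀ {v} → v ∈ sfElim r → v ∉ zs
    elim∉zs = Unique-++⇒∉ʳ (sfElim r) distinct

    separated : ∀ {u v} → u ≢ v → u ∉ X → u ∉ zs → v ∉ X → v ∉ zs →
                ¬ (∀ g → corrected g u ≡ corrected g v)
    separated {u} {v} u≢v u∉X u∉zs v∉X v∉zs same = d₁≢d₂ (begin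
      d₁            ≡⟨ [≔]-≡ (λ _ → d₂) u d₁ ⟨
      g u           ≡⟨ corrected-agrees g u u∉X u∉zs ⟨
      corrected g u ≡⟨ same g ⟩
      corrected g v ≡⟨ corrected-agrees g v v∉X v∉zs ⟩
      g v           ≡⟨ [≔]-≢ (λ _ → d₂) u d₁ (u≢v ∘ sym) ⟩
      d₂            ∎)
      where
        open ≡-Reasoning
        g : Valuation J
        g = (λ _ → d₂) [ u ≔ d₁ ]

    rhs-∈X : ∀ {v s} → (v , s) ∈ eqs → v ∉ X → ∃ λ w → s ≡ var w × w ∈ X
    rhs-∈X {v} {fn f ts} e∈ v∉X = ⊥-elim (FEA⇒fun-not-onto (fea , d₁ , d₂ , d₁≢d₂) f onto)
      where
        onto : ∀ d → ∃ λ ds → d ≡ fun f ds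
        onto d = evals J ts (corrected (λ _ → d)) ,
                 trans (sym (corrected-agrees _ v v∉X (elim∉zs (∈-map⁺ proj₁ e∈)))) (corrected-satisfies _ e∈)
    rhs-∈X {v} {var w} e∈ v∉X with w ∈? X
    ... | yes w∈X = w , refl , w∈X
    ... | no w∉X  = ⊥-elim (separated (x-not-in-s v∈elim e∈) v∉X (elim∉zs v∈elim) w∉X
                                      (λ w∈zs → z-not-s w∈zs e∈ refl) (λ g → corrected-satisfies g e∈))
      where v∈elim = ∈-map⁺ proj₁ e∈

    target : Var × Term L → Var
    target (v , s) with v ∈? X
    ... | yes _ = v
    ... | no _  = rhsVar s
      where
        -- The default v is never used: rhs-∈X shows s is a variable.
        rhsVar : Term L → Var
        rhsVar (var w)  = w
        rhsVar (fn _ _) = v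

    target-∈X : ∀ {e} → e ∈ eqs → target e ∈ X
    target-∈X {v , s} e∈ with v ∈? X
    ... | yes v∈X = v∈X
    ... | no v∉X with rhs-∈X e∈ v∉X
    ...   | _ , refl , w∈X = w∈X

    target-separates : ∀ {a b} → a ∈ eqs → b ∈ eqs → proj₁ a ≢ proj₁ b → target a ≢ target b
    target-separates {v₁ , s₁} {v₂ , s₂} a∈ b∈ v₁≢v₂ with v₁ ∈? X | v₂ ∈? X
    ... | yes _ | yes _ = v₁≢v₂
    ... | yes _ | no v₂∉X with rhs-∈X b∈ v₂∉X
    ...   | _ , refl , _ = x-not-in-s (∈-map⁺ proj₁ a∈) b∈
    target-separates {v₁ , s₁} {v₂ , s₂} a∈ b∈ v₁≢v₂ | no v₁∉X | yes _ with rhs-∈X a∈ v₁∉X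
    ...   | _ , refl , _ = x-not-in-s (∈-map⁺ proj₁ b∈) a∈ ∘ sym
    target-separates {v₁ , s₁} {v₂ , s₂} a∈ b∈ v₁≢v₂ | no v₁∉X | no v₂∉X
      with rhs-∈X a∈ v₁∉X | rhs-∈X b∈ v₂∉X
    ... | w , refl , _ | _ , refl , _ = λ { refl →
      separated v₁≢v₂ v₁∉X (elim∉zs (∈-map⁺ proj₁ a∈)) v₂∉X (elim∉zs (∈-map⁺ proj₁ b∈))
        (λ g → trans (corrected-satisfies g a∈) (sym (corrected-satisfies g b∈))) }

    sfElim-length≤ : length (sfElim r) ≤ length X
    sfElim-length≤ = begin
      length (map proj₁ eqs)  ≡⟨ length-map proj₁ eqs ⟩
      length eqs              ≡⟨ length-map target eqs ⟨
      length (map target eqs) ≤⟨ Unique⇒length≤ targets! targets⊆X ⟩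
      length X                ∎
      where
        open ≤-Reasoning
        targets! : Unique (map target eqs)
        targets! = Unique-map-finer target-separates (Unique-++⁻ˡ (sfElim r) distinct)
        targets⊆X : map target eqs ⊆ X
        targets⊆X t∈ with ∈-map⁻ target t∈
        ... | _ , e∈ , refl = target-∈X e∈

lemma4p2 : (L : Lang) (J : PreInterp L) → NonTrivialModel J →
           (Q Q' : Query L) → Consistent Q → Consistent Q' →
           (sQ : SolvedForm Q) (sQ' : SolvedForm Q') →
           Q ≼[ J ] Q' →
           length (ELIM sQ') ≤ length (ELIM sQ)
lemma4p2 L J _ Q Q' _ _ sQ (sf-true _)  _ = z≤n
lemma4p2 L J _ Q Q' _ _ sQ (sf-false _) _ = z≤n
lemma4p2 L J (fea , _ , _ , d₁≢d₂) Q _ consistentQ _ sQ (sf-ex r' wf' refl) Q≼Q' =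
  ElimBound.sfElim-length≤ {J = J} fea d₁≢d₂ (ELIM sQ) r' wf'
    (CorrectableOn-≼ {Q = Q} {Q' = sfQuery r'} (SolvedForm-correctable consistentQ sQ) Q≼Q')
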